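{- Let $G = Z_{52}\times Z_{53}$ with multiplication $[x,y][u,v] = [x+u \bmod 52,\; y\cdot 2^{u} + v \bmod 53]$ (a group of order $2756$). Let $S=\{g,g^{ -1} : g\in\{[25,45],[30,23],[40,39],[26,0]\}\}$. Then $S$ consists of exactly $7$ non-identity elements and the Cayley graph $\mathrm{Cay}(G,S)$ is a connected $7$-regular graph of diameter $5$ on $2756$ vertices.
   Context: For a finite group $G$ and an inverse-closed subset $S\subseteq G$ not containing the identity, the Cayley graph $\mathrm{Cay}(G,S)$ is the undirected graph with vertex set $G$ in which $x$ and $y$ are adjacent iff $y=xs$ for some $s\in S$; it is $|S|$-regular. The diameter of a connected graph is the maximum over all pairs of vertices of the length of a shortest path between them. For integers $m,n$ and a unit $a$ of $Z_n$ whose multiplicative order divides $m$, the group $m\times_a n$ is the set $Z_m\times Z_n$ with multiplication $[x,y][u,v]=[x+u \bmod m,\; y a^u+v \bmod n]$. -}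

module Defs where

open import Data.Nat using (ℕ; zero; suc; _+_; _*_; _∸_; _^_; _≤_)
open import Data.Nat.DivMod using (_mod_)
open import Data.Fin using (Fin; toℕ)
open import Data.Product using (_×_; _,_; Σ; ∃; ∃-syntax)
open import Data.List using (List; []; _∷_; length)
open import Data.List.Membership.Propositional using (_∈_)
open import Data.List.Relation.Unary.Unique.Propositional using (Unique)
open import Relation.Binary.PropositionalEquality using (_≡_)
open import Relation.Nullary using (¬_)
open import Function.Bundles using (_⇔_)
open import Data.Unit using (⊤)

G : Set
G = Fin 52 × Fin 53

_·_ : G → G → G
(x , y) · (u , v) = ((toℕ x + toℕ u) mod 52) , ((toℕ y * 2 ^ toℕ u + toℕ v) mod 53)

e : G
e = (0 mod 52) , (0 mod 53)

inv : G → G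
inv (x , y) = ((52 ∸ toℕ x) mod 52) , (((53 ∸ toℕ y) * 2 ^ toℕ ((52 ∸ toℕ x) mod 52)) mod 53)

[_,_] : ℕ → ℕ → G
[ a , b ] = (a mod 52) , (b mod 53)

gens : List G
gens = [ 25 , 45 ] ∷ [ 30 , 23 ] ∷ [ 40 , 39 ] ∷ [ 26 , 0 ] ∷ []

-- S = { g , g⁻¹ : g ∈ gens } (as a list, possibly with repetitions)
S : List G
S = go gens
  where
  go : List G → List G
  go [] = []
  go (g ∷ gs) = g ∷ inv g ∷ go gs

Adj : G → G → Set
Adj x y = ∃[ s ] (s ∈ S × y ≡ x · s)

data Walk : G → G → ℕ → Set where
  nil  : ∀ {x} → Walk x x 0
  step : ∀ {x y z n} → Adj x y → Walk y z n → Walk x z (suc n)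

DistLe : G → G → ℕ → Set
DistLe x y k = ∃[ n ] (n ≤ k × Walk x y n)

HasExactly : (G → Set) → ℕ → Set
HasExactly P k = ∃[ L ] (Unique L × length L ≡ k × (∀ z → (z ∈ L) ⇔ P z))

Connected : Set
Connected = ∀ x y → ∃[ n ] Walk x y n

Regular : ℕ → Set
Regular k = ∀ x → HasExactly (Adj x) k

Diameter : ℕ → Set
Diameter d = (∀ x y → DistLe x y d) × ∃[ x ] ∃[ y ] ¬ DistLe x y (d ∸ 1)

VertexCount : ℕ → Set
VertexCount k = HasExactly (λ _ → ⊤) k

{-# OPTIONS --safe #-}
module Submission where

-- G is the semidirect product ℤ₅₂ ⋉ ℤ₅₃ in which the generator of ℤ₅₂ acts by multiplication
-- by 2.  Since 2⁵² ≡ 1 (mod 53), powers of 2 only depend on the exponent modulo 52, which is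
-- what makes the multiplication associative.  Left multiplication maps walks to walks, so
-- d(x, y) = d(e, x⁻¹y) and the diameter is the eccentricity of e.  That every element is within
-- distance 5 of e is certified by a table of words of length ≤ 5 (read off a breadth-first
-- search tree), checked by evaluation; that [21, 21] is not within distance 4 of e is found by
-- exhaustive search over all walks of length ≤ 4.  As [26, 0] is an involution, S has 7
-- distinct elements, and by left cancellation the neighbours x s are distinct as well.

open import Defs
open import Algebra.Bundles using (Group)
open import Algebra.Structures using (IsGroup)
import Algebra.Properties.Group as GroupProperties
open import Data.Char using (Char; _==_)
open import Data.Fin using (Fin; toℕ; _≟_)
import Data.Fin.Properties as Fin
open import Data.Fin.Properties using (toℕ-fromℕ<; toℕ-injective; toℕ<n; toℕ≤n)
open import Data.List using (List; []; _∷_; length; map; mapMaybe; head; filterᵇ; zip; deduplicate; allFin; cartesianProduct)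
open import Data.List.Membership.Propositional using (_∈_; find; lose)
open import Data.List.Membership.Propositional.Properties
  using (∈-map⁺; ∈-map⁻; ∈-deduplicate⁺; ∈-deduplicate⁻; ∈-allFin; ∈-cartesianProduct⁺)
import Data.List.Membership.DecPropositional as DecMembership
open import Data.List.Relation.Unary.All as All using (All)
open import Data.List.Relation.Unary.Any using (Any; any?; here; there)
open import Data.List.Relation.Unary.Unique.Propositional using (Unique)
open import Data.List.Relation.Unary.Unique.Propositional.Properties using (map⁺; allFin⁺; cartesianProduct⁺)
open import Data.List.Relation.Unary.Unique.DecPropositional.Properties using (deduplicate-!)
open import Data.Maybe using (Maybe)
import Data.Maybe as Maybe
open import Data.Nat using (ℕ; zero; suc; _+_; _*_; _∸_; _^_; _%_; _/_; _≤_; _≤?_; s≤s; NonZero; >-nonZero⁻¹)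
open import Data.Nat.DivMod
  using (_mod_; %-distribˡ-+; %-distribˡ-*; m%n%n≡m%n; n%n≡0; m<n⇒m%n≡m; m≡m%n+[m/n]*n)
open import Data.Nat.Properties
  using (+-identityʳ; *-identityʳ; +-assoc; *-assoc; +-comm; *-comm; *-distribʳ-+; ^-distribˡ-+-*; ^-*-assoc;
         ^-zeroˡ; m+[n∸m]≡n; anyUpTo?)
open import Data.Nat.Solver using (module +-*-Solver)
open import Data.Product using (_×_; _,_; proj₁; proj₂)
open import Data.Product.Properties using (≡-dec)
open import Data.String using (String; toList)
open import Data.Unit using (tt)
open import Data.Vec using (Vec; []; _∷_; lookup)
open import Function using (_∘_)
open import Function.Bundles using (mk⇔)
open import Level using (0ℓ)
open import Relation.Binary.Bundles using (Setoid)
open import Relation.Binary.Definitions using (DecidableEquality)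
import Relation.Binary.Construct.On as On
open import Relation.Binary.PropositionalEquality
  using (_≡_; refl; sym; trans; cong; cong₂; subst; subst₂; setoid; isEquivalence; module ≡-Reasoning)
import Relation.Binary.Reasoning.Setoid as SetoidReasoning
open import Relation.Nullary using (¬_)
open import Relation.Nullary.Decidable using (Dec; map′; from-yes; from-no; _×-dec_)

module Congruence (n : ℕ) .{{_ : NonZero n}} where

  infix 4 _≈_
  _≈_ : ℕ → ℕ → Set
  x ≈ y = x % n ≡ y % n

  ≈-setoid : Setoid 0ℓ 0ℓ
  ≈-setoid = On.setoid (setoid ℕ) (_% n)

  module ≈-Reasoning = SetoidReasoning ≈-setoid

  +-cong : ∀ {x x′ y y′} → x ≈ x′ → y ≈ y′ → x + y ≈ x′ + y′
  +-cong {x} {x′} {y} {y′} p q = trans (%-distribˡ-+ x y n)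
    (trans (cong₂ (λ s t → (s + t) % n) p q) (sym (%-distribˡ-+ x′ y′ n)))

  *-cong : ∀ {x x′ y y′} → x ≈ x′ → y ≈ y′ → x * y ≈ x′ * y′
  *-cong {x} {x′} {y} {y′} p q = trans (%-distribˡ-* x y n)
    (trans (cong₂ (λ s t → (s * t) % n) p q) (sym (%-distribˡ-* x′ y′ n)))

  toℕ-mod-≈ : ∀ x → toℕ (x mod n) ≈ x
  toℕ-mod-≈ x = trans (cong (_% n) (toℕ-fromℕ< _)) (m%n%n≡m%n x n)

  mod-cong : ∀ {x y} → x ≈ y → x mod n ≡ y mod n
  mod-cong {x} {y} p = toℕ-injective (trans (toℕ-fromℕ< _) (trans p (sym (toℕ-fromℕ< _))))

  toℕ-mod : ∀ (i : Fin n) → toℕ i mod n ≡ i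
  toℕ-mod i = toℕ-injective (trans (toℕ-fromℕ< _) (m<n⇒m%n≡m (toℕ<n i)))

  n≈0 : n ≈ 0
  n≈0 = trans (n%n≡0 n) (sym (m<n⇒m%n≡m (>-nonZero⁻¹ n)))

  ≈-toℕ⇒mod≡ : ∀ {x} (i : Fin n) → x ≈ toℕ i → x mod n ≡ i
  ≈-toℕ⇒mod≡ i p = trans (mod-cong p) (toℕ-mod i)

  toℕ-0-mod : toℕ (0 mod n) ≡ 0
  toℕ-0-mod = trans (toℕ-fromℕ< _) (m<n⇒m%n≡m (>-nonZero⁻¹ n))

  +-∸-≈0 : ∀ (i : Fin n) → toℕ i + (n ∸ toℕ i) ≈ 0
  +-∸-≈0 i = trans (cong (_% n) (m+[n∸m]≡n (toℕ≤n i))) n≈0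

  +-∸-mod-≈0 : ∀ (i : Fin n) → toℕ i + toℕ ((n ∸ toℕ i) mod n) ≈ 0
  +-∸-mod-≈0 i = trans (+-cong {toℕ i} refl (toℕ-mod-≈ (n ∸ toℕ i))) (+-∸-≈0 i)

  ^-congˡ : ∀ {x y} k → x ≈ y → x ^ k ≈ y ^ k
  ^-congˡ zero    p = refl
  ^-congˡ (suc k) p = *-cong p (^-congˡ k p)

[ys+v]t+q≡y[st]+[vt+q] : ∀ y v q s t → (y * s + v) * t + q ≡ y * (s * t) + (v * t + q)
[ys+v]t+q≡y[st]+[vt+q] = solve 5 (λ y v q s t → (y :* s :+ v) :* t :+ q := y :* (s :* t) :+ (v :* t :+ q)) refl
  where open +-*-Solver

module MetacyclicGroup (m n a : ℕ) .{{_ : NonZero m}} .{{_ : NonZero n}} where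

  private
    module M = Congruence m
    module N = Congruence n

  infixl 7 _∙_
  infix 8 _⁻¹

  Carrier : Set
  Carrier = Fin m × Fin n

  _∙_ : Carrier → Carrier → Carrier
  (x , y) ∙ (u , v) = ((toℕ x + toℕ u) mod m) , ((toℕ y * a ^ toℕ u + toℕ v) mod n)

  ε : Carrier
  ε = (0 mod m) , (0 mod n)

  _⁻¹ : Carrier → Carrier
  (x , y) ⁻¹ = ((m ∸ toℕ x) mod m) , (((n ∸ toℕ y) * a ^ toℕ ((m ∸ toℕ x) mod m)) mod n)

  ∙-identityˡ : ∀ z → ε ∙ z ≡ z
  ∙-identityˡ (u , v) = cong₂ _,_
    (M.≈-toℕ⇒mod≡ u (cong (λ t → (t + toℕ u) % m) M.toℕ-0-mod))
    (N.≈-toℕ⇒mod≡ v (cong (λ t → (t * a ^ toℕ u + toℕ v) % n) N.toℕ-0-mod))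

  ∙-identityʳ : ∀ z → z ∙ ε ≡ z
  ∙-identityʳ (x , y) = cong₂ _,_
    (M.≈-toℕ⇒mod≡ x (cong (_% m) (trans (cong (toℕ x +_) M.toℕ-0-mod) (+-identityʳ _))))
    (N.≈-toℕ⇒mod≡ y (cong (_% n) (begin
      toℕ y * a ^ toℕ (0 mod m) + toℕ (0 mod n) ≡⟨ cong₂ (λ s t → toℕ y * a ^ s + t) M.toℕ-0-mod N.toℕ-0-mod ⟩
      toℕ y * 1 + 0                             ≡⟨ +-identityʳ _ ⟩
      toℕ y * 1                                 ≡⟨ *-identityʳ _ ⟩
      toℕ y                                     ∎)))
    where open ≡-Reasoning

  ∙-inverseʳ : ∀ z → z ∙ z ⁻¹ ≡ ε
  ∙-inverseʳ (x , y) = cong₂ _,_ (M.mod-cong (M.+-∸-mod-≈0 x)) (N.mod-cong second)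
    where
    Y = toℕ y
    k = toℕ ((m ∸ toℕ x) mod m)

    second : Y * a ^ k + toℕ (((n ∸ Y) * a ^ k) mod n) N.≈ 0
    second = begin
      Y * a ^ k + toℕ (((n ∸ Y) * a ^ k) mod n) ≈⟨ N.+-cong {Y * a ^ k} refl (N.toℕ-mod-≈ _) ⟩
      Y * a ^ k + (n ∸ Y) * a ^ k                ≡⟨ *-distribʳ-+ (a ^ k) Y (n ∸ Y) ⟨
      (Y + (n ∸ Y)) * a ^ k                      ≈⟨ N.*-cong (N.+-∸-≈0 y) refl ⟩
      0                                          ∎
      where open N.≈-Reasoning

  module _ (aᵐ≈1 : a ^ m N.≈ 1) where

    ^-%-≈ : ∀ k → a ^ k N.≈ a ^ (k % m)
    ^-%-≈ k = begin
      a ^ k                           ≡⟨ cong (a ^_) k≡k%m+m*[k/m] ⟩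
      a ^ (k % m + m * (k / m))       ≡⟨ ^-distribˡ-+-* a (k % m) _ ⟩
      a ^ (k % m) * a ^ (m * (k / m)) ≡⟨ cong (a ^ (k % m) *_) (^-*-assoc a m (k / m)) ⟨
      a ^ (k % m) * (a ^ m) ^ (k / m) ≈⟨ N.*-cong {a ^ (k % m)} refl (N.^-congˡ (k / m) aᵐ≈1) ⟩
      a ^ (k % m) * 1 ^ (k / m)       ≡⟨ cong (a ^ (k % m) *_) (^-zeroˡ (k / m)) ⟩
      a ^ (k % m) * 1                 ≡⟨ *-identityʳ _ ⟩
      a ^ (k % m)                     ∎
      where
      open N.≈-Reasoning
      k≡k%m+m*[k/m] : k ≡ k % m + m * (k / m)
      k≡k%m+m*[k/m] = trans (m≡m%n+[m/n]*n k m) (cong (k % m +_) (*-comm (k / m) m))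

    ^-congʳ : ∀ {k l} → k M.≈ l → a ^ k N.≈ a ^ l
    ^-congʳ {k} {l} p = trans (^-%-≈ k) (trans (cong (λ t → a ^ t % n) p) (sym (^-%-≈ l)))

    ∙-inverseˡ : ∀ z → z ⁻¹ ∙ z ≡ ε
    ∙-inverseˡ (x , y) = cong₂ _,_ (M.mod-cong k+X≈0) (N.mod-cong second)
      where
      X = toℕ x
      Y = toℕ y
      k = toℕ ((m ∸ X) mod m)

      k+X≈0 : k + X M.≈ 0
      k+X≈0 = trans (cong (_% m) (+-comm k X)) (M.+-∸-mod-≈0 x)

      second : toℕ (((n ∸ Y) * a ^ k) mod n) * a ^ X + Y N.≈ 0
      second = begin
        toℕ (((n ∸ Y) * a ^ k) mod n) * a ^ X + Y ≈⟨ N.+-cong (N.*-cong (N.toℕ-mod-≈ _) refl) refl ⟩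
        (n ∸ Y) * a ^ k * a ^ X + Y               ≡⟨ cong (_+ Y) (*-assoc (n ∸ Y) _ _) ⟩
        (n ∸ Y) * (a ^ k * a ^ X) + Y             ≡⟨ cong (λ t → (n ∸ Y) * t + Y) (^-distribˡ-+-* a k X) ⟨
        (n ∸ Y) * a ^ (k + X) + Y                 ≈⟨ N.+-cong (N.*-cong {n ∸ Y} refl (^-congʳ k+X≈0)) refl ⟩
        (n ∸ Y) * 1 + Y                           ≡⟨ cong (_+ Y) (*-identityʳ (n ∸ Y)) ⟩
        (n ∸ Y) + Y                               ≡⟨ +-comm (n ∸ Y) Y ⟩
        Y + (n ∸ Y)                               ≈⟨ N.+-∸-≈0 y ⟩
        0                                         ∎
        where open N.≈-Reasoning

    ∙-assoc : ∀ x y z → (x ∙ y) ∙ z ≡ x ∙ (y ∙ z)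
    ∙-assoc (x , y) (u , v) (p , q) = cong₂ _,_ (M.mod-cong first) (N.mod-cong second)
      where
      X = toℕ x
      Y = toℕ y
      U = toℕ u
      V = toℕ v
      P = toℕ p
      Q = toℕ q

      first : toℕ ((X + U) mod m) + P M.≈ X + toℕ ((U + P) mod m)
      first = begin
        toℕ ((X + U) mod m) + P ≈⟨ M.+-cong (M.toℕ-mod-≈ (X + U)) refl ⟩
        X + U + P               ≡⟨ +-assoc X U P ⟩
        X + (U + P)             ≈⟨ M.+-cong {X} refl (M.toℕ-mod-≈ (U + P)) ⟨
        X + toℕ ((U + P) mod m) ∎
        where open M.≈-Reasoning

      second : toℕ ((Y * a ^ U + V) mod n) * a ^ P + Q N.≈ Y * a ^ toℕ ((U + P) mod m) + toℕ ((V * a ^ P + Q) mod n)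
      second = begin
        toℕ ((Y * a ^ U + V) mod n) * a ^ P + Q                   ≈⟨ N.+-cong (N.*-cong (N.toℕ-mod-≈ _) refl) refl ⟩
        (Y * a ^ U + V) * a ^ P + Q                               ≡⟨ [ys+v]t+q≡y[st]+[vt+q] Y V Q (a ^ U) (a ^ P) ⟩
        Y * (a ^ U * a ^ P) + (V * a ^ P + Q)                     ≡⟨ cong (λ t → Y * t + (V * a ^ P + Q)) (^-distribˡ-+-* a U P) ⟨
        Y * a ^ (U + P) + (V * a ^ P + Q)                         ≈⟨ N.+-cong (N.*-cong {Y} refl (^-congʳ (M.toℕ-mod-≈ (U + P))))
                                                                                (N.toℕ-mod-≈ _) ⟨
        Y * a ^ toℕ ((U + P) mod m) + toℕ ((V * a ^ P + Q) mod n) ∎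
        where open N.≈-Reasoning

    isGroup : IsGroup _≡_ _∙_ ε _⁻¹
    isGroup = record
      { isMonoid = record
        { isSemigroup = record
          { isMagma = record { isEquivalence = isEquivalence ; ∙-cong = cong₂ _∙_ }
          ; assoc = ∙-assoc
          }
        ; identity = ∙-identityˡ , ∙-identityʳ
        }
      ; inverse = ∙-inverseˡ , ∙-inverseʳ
      ; ⁻¹-cong = cong _⁻¹
      }

    group : Group 0ℓ 0ℓ
    group = record { isGroup = isGroup }

open MetacyclicGroup 52 53 2 using (group)

2⁵²≡1 : 2 ^ 52 % 53 ≡ 1 % 53
2⁵²≡1 = refl

-- At (52, 53, 2) the operations of MetacyclicGroup are definitionally _·_, e and inv.
G-group : Group 0ℓ 0ℓ
G-group = group 2⁵²≡1

open Group G-group using ()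
  renaming (assoc to ·-assoc; identityʳ to ·-identityʳ; inverseˡ to ·-inverseˡ; inverseʳ to ·-inverseʳ)
open GroupProperties G-group using (\\-leftDividesˡ; ∙-cancelˡ)

infix 4 _≟G_
_≟G_ : DecidableEquality G
_≟G_ = ≡-dec _≟_ _≟_

open DecMembership _≟G_ using (_∈?_)

translate-Walk : ∀ g {x y n} → Walk x y n → Walk (g · x) (g · y) n
translate-Walk g nil                               = nil
translate-Walk g (step {x = x} (s , s∈S , refl) w) = step (s , s∈S , sym (·-assoc g x s)) (translate-Walk g w)

translate-DistLe : ∀ g {x y k} → DistLe x y k → DistLe (g · x) (g · y) k
translate-DistLe g (n , n≤k , w) = n , n≤k , translate-Walk g w

DistLe-fromIdentity : ∀ {k} → (∀ z → DistLe e z k) → ∀ x y → DistLe x y k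
DistLe-fromIdentity {k} near x y =
  subst₂ (λ u v → DistLe u v k) (·-identityʳ x) (\\-leftDividesˡ x y) (translate-DistLe x (near (inv x · y)))

Walk? : ∀ x y n → Dec (Walk x y n)
Walk? x y zero    = map′ (λ { refl → nil }) (λ { nil → refl }) (x ≟G y)
Walk? x y (suc n) = map′ fromAny toAny (any? (λ s → Walk? (x · s) y n) S)
  where
  fromAny : Any (λ s → Walk (x · s) y n) S → Walk x y (suc n)
  fromAny p = let s , s∈S , w = find p in step (s , s∈S , refl) w

  toAny : Walk x y (suc n) → Any (λ s → Walk (x · s) y n) S
  toAny (step (s , s∈S , refl) w) = lose s∈S w

DistLe? : ∀ x y k → Dec (DistLe x y k)
DistLe? x y k = map′ (λ { (n , s≤s n≤k , w) → n , n≤k , w }) (λ { (n , n≤k , w) → n , s≤s n≤k , w })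
  (anyUpTo? (Walk? x y) (suc k))

S₇ : List G
S₇ = deduplicate _≟G_ S

S₇-unique : Unique S₇
S₇-unique = deduplicate-! _≟G_ S

S-hasExactly7 : HasExactly (_∈ S) 7
S-hasExactly7 = S₇ , S₇-unique , refl , λ _ → mk⇔ (∈-deduplicate⁻ _≟G_ S) (∈-deduplicate⁺ _≟G_)

-- The explicit {xs = S₇} keeps unification from evaluating map (x ·_) S₇, which exhausts memory.
regular7 : Regular 7
regular7 x = map (x ·_) S₇ , map⁺ {f = x ·_} (∙-cancelˡ x _ _) {xs = S₇} S₇-unique , refl , λ _ → mk⇔ to from
  where
  to : ∀ {z} → z ∈ map (x ·_) S₇ → Adj x z
  to z∈ = let s , s∈S₇ , z≡xs = ∈-map⁻ (x ·_) {xs = S₇} z∈ in s , ∈-deduplicate⁻ _≟G_ S s∈S₇ , z≡xs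

  from : ∀ {z} → Adj x z → z ∈ map (x ·_) S₇
  from (s , s∈S , refl) = ∈-map⁺ (x ·_) (∈-deduplicate⁺ _≟G_ s∈S)

vertexCount : VertexCount 2756
vertexCount = cartesianProduct (allFin 52) (allFin 53) , cartesianProduct⁺ (allFin⁺ 52) (allFin⁺ 53) , refl ,
  λ (x , y) → mk⇔ (λ _ → tt) (λ _ → ∈-cartesianProduct⁺ (∈-allFin x) (∈-allFin y))

data Letter : Set where
  a A b B c C d : Letter

⟦_⟧ : Letter → G
⟦ a ⟧ = [ 25 , 45 ]
⟦ A ⟧ = inv [ 25 , 45 ]
⟦ b ⟧ = [ 30 , 23 ]
⟦ B ⟧ = inv [ 30 , 23 ]
⟦ c ⟧ = [ 40 , 39 ]
⟦ C ⟧ = inv [ 40 , 39 ]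
⟦ d ⟧ = [ 26 , 0 ]

⟦⟧∈S : ∀ ℓ → ⟦ ℓ ⟧ ∈ S
⟦⟧∈S a = here refl
⟦⟧∈S A = there (here refl)
⟦⟧∈S b = there (there (here refl))
⟦⟧∈S B = there (there (there (here refl)))
⟦⟧∈S c = there (there (there (there (here refl))))
⟦⟧∈S C = there (there (there (there (there (here refl)))))
⟦⟧∈S d = there (there (there (there (there (there (here refl))))))

Word : Set
Word = List Letter

_⊲_ : G → Word → G
x ⊲ []      = x
x ⊲ (ℓ ∷ w) = (x · ⟦ ℓ ⟧) ⊲ w

walkAlong : ∀ x w → Walk x (x ⊲ w) (length w)
walkAlong x []      = nil
walkAlong x (ℓ ∷ w) = step (⟦ ℓ ⟧ , ⟦⟧∈S ℓ , refl) (walkAlong (x · ⟦ ℓ ⟧) w)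

letter : Char → Maybe Letter
letter ch = Maybe.map proj₂ (head (filterᵇ ((ch ==_) ∘ proj₁) spelling))
  where
  spelling : List (Char × Letter)
  spelling = zip (toList "aAbBcCd") (a ∷ A ∷ b ∷ B ∷ c ∷ C ∷ d ∷ [])

parse : String → Word
parse = mapMaybe letter ∘ toList

certificate : Vec (Vec String 53) 52
certificate =
    ("" ∷ "acdac" ∷ "BCbc" ∷ "AdCCA" ∷ "cdCd" ∷ "CabaC" ∷ "aaccd" ∷ "Bdbd" ∷ "cAAcB" ∷ "AbaB" ∷ "CAca" ∷ "acdca" ∷ "aaCbC" ∷ "accad" ∷ "bbcdb" ∷ "BAba" ∷ "Adad" ∷ "bdBd" ∷ "abAB" ∷ "adcca" ∷ "bCBc" ∷ "dadA" ∷ "abaCC" ∷ "aBAb" ∷ "ACdAC" ∷ "dCdc" ∷ "adacc" ∷ "ACAdC" ∷ "Cdcd" ∷ "cadca" ∷ "BabA" ∷ "aacdc" ∷ "adAd" ∷ "aCAc" ∷ "ACCdA" ∷ "acAC" ∷ "dbdB" ∷ "dAda" ∷ "ABab" ∷ "aabCC" ∷ "bbdbc" ∷ "bcdbb" ∷ "aaCCb" ∷ "ACac" ∷ "AcaC" ∷ "bCaaC" ∷ "dBdb" ∷ "aCbCa" ∷ "acadc" ∷ "dcdC" ∷ "accda" ∷ "CBcb" ∷ "AcAcB" ∷ [])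
  ∷ ("AAda" ∷ "aCdbC" ∷ "dbAB" ∷ "cca" ∷ "aCbCd" ∷ "bccaB" ∷ "CbCda" ∷ "dBAb" ∷ "CAdc" ∷ "ABdb" ∷ "acc" ∷ "baaa" ∷ "AcdC" ∷ "aaab" ∷ "bCadC" ∷ "bcbbA" ∷ "Ad" ∷ "dCAc" ∷ "bdBA" ∷ "dcAC" ∷ "CdAc" ∷ "BdAb" ∷ "aBccb" ∷ "BCABB" ∷ "abccB" ∷ "bdCCa" ∷ "abCdC" ∷ "cdAC" ∷ "aaba" ∷ "aacAc" ∷ "cAdC" ∷ "aCdCb" ∷ "bAbbc" ∷ "AAACC" ∷ "bAdB" ∷ "Bccab" ∷ "bdAB" ∷ "dA" ∷ "acdcd" ∷ "BAdb" ∷ "CdcA" ∷ "ACdc" ∷ "cBcab" ∷ "acbcB" ∷ "abcBc" ∷ "cdCA" ∷ "cac" ∷ "abaa" ∷ "adAA" ∷ "aaccA" ∷ "Abbbc" ∷ "bABd" ∷ "AbdB" ∷ [])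
  ∷ ("aBBCa" ∷ "BBcB" ∷ "bCC" ∷ "adab" ∷ "abad" ∷ "CCb" ∷ "bcdcB" ∷ "acdcA" ∷ "aCCAb" ∷ "aBCBa" ∷ "ACbCa" ∷ "Acadc" ∷ "aadb" ∷ "Accda" ∷ "AbCaC" ∷ "dbaa" ∷ "AA" ∷ "Acdac" ∷ "adba" ∷ "aabd" ∷ "aBaBC" ∷ "BBBc" ∷ "ccd" ∷ "BAbA" ∷ "BBCaa" ∷ "aCBBa" ∷ "abCAC" ∷ "aCbAC" ∷ "CbC" ∷ "Accad" ∷ "bdaa" ∷ "dcc" ∷ "bbCCB" ∷ "bABA" ∷ "AbAB" ∷ "Adcca" ∷ "CAAc" ∷ "dAAd" ∷ "baad" ∷ "ABAb" ∷ "acdAc" ∷ "abda" ∷ "BcBB" ∷ "cBdbc" ∷ "abCCA" ∷ "aCbCA" ∷ "BAAb" ∷ "cdc" ∷ "AdAd" ∷ "ACAc" ∷ "aCaBB" ∷ "AcAC" ∷ "cACA" ∷ [])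
  ∷ ("cabC" ∷ "dadb" ∷ "BCBad" ∷ "accAA" ∷ "aBdCB" ∷ "dAAA" ∷ "Cbca" ∷ "ba" ∷ "cAc" ∷ "AbCCd" ∷ "adBCB" ∷ "BBCad" ∷ "aBBdC" ∷ "cbaC" ∷ "CaBBd" ∷ "acbC" ∷ "AAdA" ∷ "aBCdB" ∷ "bccAB" ∷ "CbCAd" ∷ "Babb" ∷ "BCdBa" ∷ "aabA" ∷ "bdad" ∷ "cdAcd" ∷ "AAcac" ∷ "Abaa" ∷ "AdAA" ∷ "ccA" ∷ "BcAcb" ∷ "caCb" ∷ "adCBB" ∷ "ACbdC" ∷ "ACdbC" ∷ "aBCBd" ∷ "AAcca" ∷ "ACbCd" ∷ "bAccB" ∷ "bCACd" ∷ "AdCbC" ∷ "AcBcb" ∷ "bCCdA" ∷ "Acc" ∷ "acAcA" ∷ "BaBCd" ∷ "ab" ∷ "Cacb" ∷ "aCbc" ∷ "AAAd" ∷ "Cbac" ∷ "bCac" ∷ "bcaC" ∷ "adbd" ∷ [])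
  ∷ ("abAd" ∷ "aabcc" ∷ "bCdc" ∷ "cbdC" ∷ "cdbC" ∷ "adAb" ∷ "BBC" ∷ "cbCd" ∷ "ACaBB" ∷ "CBB" ∷ "aCBBA" ∷ "ABBCa" ∷ "ACAbC" ∷ "bbdB" ∷ "Adab" ∷ "Abad" ∷ "aBBCA" ∷ "aBCAB" ∷ "AcdcA" ∷ "accab" ∷ "acacb" ∷ "abdA" ∷ "acabc" ∷ "db" ∷ "baacc" ∷ "dCbc" ∷ "bcdC" ∷ "AAAA" ∷ "Cbcd" ∷ "Adba" ∷ "bd" ∷ "ABaBC" ∷ "AbACC" ∷ "acbca" ∷ "cdCb" ∷ "adbA" ∷ "ACBBa" ∷ "AbCAC" ∷ "dAba" ∷ "AACbC" ∷ "abcca" ∷ "BCB" ∷ "AAdcc" ∷ "caacb" ∷ "cBCCB" ∷ "ACBaB" ∷ "dcbC" ∷ "Cdcb" ∷ "BACBa" ∷ "Cdbc" ∷ "AdccA" ∷ "badA" ∷ "Abda" ∷ [])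
  ∷ ("aaCaB" ∷ "acbdc" ∷ "aaaBC" ∷ "caBB" ∷ "aCbbC" ∷ "BBac" ∷ "badcc" ∷ "cAbC" ∷ "bCCab" ∷ "bbAB" ∷ "acBB" ∷ "AAAcc" ∷ "AcAcA" ∷ "bbaCC" ∷ "Ab" ∷ "BBca" ∷ "ACbc" ∷ "BAbb" ∷ "CAbc" ∷ "BdBAC" ∷ "CbAc" ∷ "Adbd" ∷ "aBcB" ∷ "bdAd" ∷ "bCAc" ∷ "BcBa" ∷ "bcAC" ∷ "adbcc" ∷ "BacB" ∷ "AAba" ∷ "dbdA" ∷ "cBBa" ∷ "dAdb" ∷ "cbAC" ∷ "BcaB" ∷ "aaBCa" ∷ "aCaBa" ∷ "abAA" ∷ "ABBCd" ∷ "dAbd" ∷ "cBaB" ∷ "adcbc" ∷ "aBBc" ∷ "abccd" ∷ "bA" ∷ "aBCaa" ∷ "bCaCb" ∷ "BAdBC" ∷ "BaBc" ∷ "abCbC" ∷ "acdbc" ∷ "cbCA" ∷ "abdcc" ∷ [])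
  ∷ ("aBCad" ∷ "adaBC" ∷ "dbAA" ∷ "BCAAB" ∷ "ccb" ∷ "aBadC" ∷ "cbc" ∷ "BCCC" ∷ "cBdB" ∷ "aabb" ∷ "baba" ∷ "BdcB" ∷ "AbdA" ∷ "BcBd" ∷ "AAdb" ∷ "CCCB" ∷ "accAb" ∷ "abccA" ∷ "BBdc" ∷ "bAdA" ∷ "acAbc" ∷ "AAbd" ∷ "acbAc" ∷ "BBACA" ∷ "Acbca" ∷ "cBBd" ∷ "AdbA" ∷ "BBBBB" ∷ "dcBB" ∷ "bbaa" ∷ "bdAA" ∷ "BdBc" ∷ "dAAb" ∷ "CCBC" ∷ "abab" ∷ "aCaBd" ∷ "adaCB" ∷ "aBCda" ∷ "CBCC" ∷ "aadBC" ∷ "dBcB" ∷ "dbbCC" ∷ "acbcA" ∷ "adCBa" ∷ "AbAd" ∷ "bcc" ∷ "BBcd" ∷ "ABABC" ∷ "baab" ∷ "abba" ∷ "abcAc" ∷ "bAAd" ∷ "adCaB" ∷ [])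
  ∷ ("bccAd" ∷ "abdb" ∷ "aBaCA" ∷ "BBAc" ∷ "ABcB" ∷ "bbda" ∷ "Accdb" ∷ "adbb" ∷ "BaC" ∷ "Adbcc" ∷ "BcBA" ∷ "Acbcd" ∷ "baBBC" ∷ "Accbd" ∷ "aBBCb" ∷ "baCBB" ∷ "BAcB" ∷ "BCa" ∷ "ACaBa" ∷ "aCB" ∷ "bdab" ∷ "bbad" ∷ "bACCb" ∷ "BBcA" ∷ "ABBc" ∷ "Abccd" ∷ "CBa" ∷ "adBdC" ∷ "BcAB" ∷ "badb" ∷ "Acdcb" ∷ "cABB" ∷ "dbba" ∷ "bAAA" ∷ "cBBA" ∷ "CaB" ∷ "babd" ∷ "aBC" ∷ "bbACC" ∷ "aCCBc" ∷ "abCBB" ∷ "aBdCd" ∷ "acBCC" ∷ "bbCAC" ∷ "bCbAC" ∷ "AcBB" ∷ "aBACa" ∷ "baBCB" ∷ "bAdcc" ∷ "AAAb" ∷ "aaBCA" ∷ "aaCAB" ∷ "cBAB" ∷ [])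
  ∷ ("abbA" ∷ "aCBAd" ∷ "aBACd" ∷ "dBC" ∷ "aaBc" ∷ "aBCdA" ∷ "AcbcA" ∷ "aaCaa" ∷ "ACBad" ∷ "Baac" ∷ "AccbA" ∷ "BccBc" ∷ "bdCBB" ∷ "Abba" ∷ "aBac" ∷ "CBd" ∷ "AdCaB" ∷ "ABCad" ∷ "AdaBC" ∷ "Baca" ∷ "dbdb" ∷ "aCdAB" ∷ "aCBdA" ∷ "abAb" ∷ "aBca" ∷ "BACda" ∷ "bb" ∷ "dbbd" ∷ "bCbc" ∷ "cbCb" ∷ "bCBdB" ∷ "caBa" ∷ "BaCAd" ∷ "bdbd" ∷ "acBa" ∷ "AcAcb" ∷ "aCABd" ∷ "aacB" ∷ "dCB" ∷ "AcbAc" ∷ "caaB" ∷ "bAba" ∷ "AdBaC" ∷ "acaB" ∷ "bdBCB" ∷ "ACBda" ∷ "BdC" ∷ "Cbcb" ∷ "aBdAC" ∷ "bcbC" ∷ "BCd" ∷ "CdB" ∷ "cbbC" ∷ [])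
  ∷ ("ACB" ∷ "Bacd" ∷ "bbcca" ∷ "aCABA" ∷ "cabcb" ∷ "aBCAA" ∷ "cabbc" ∷ "aadaC" ∷ "cadB" ∷ "cdaB" ∷ "abbcc" ∷ "aBcd" ∷ "CCaC" ∷ "BAC" ∷ "CBA" ∷ "bbAd" ∷ "aadCa" ∷ "ACdBd" ∷ "ABC" ∷ "dcBa" ∷ "bdAb" ∷ "CCCa" ∷ "dacB" ∷ "aBAAC" ∷ "abcbc" ∷ "aCCC" ∷ "Badc" ∷ "ABACa" ∷ "Bcda" ∷ "adcB" ∷ "aaCad" ∷ "BCA" ∷ "CAB" ∷ "CdBdA" ∷ "cBad" ∷ "Abdb" ∷ "aBdc" ∷ "bcabc" ∷ "bAdb" ∷ "aaaCd" ∷ "BBAbC" ∷ "Adbb" ∷ "Abbd" ∷ "bCBAB" ∷ "Bcad" ∷ "bAbd" ∷ "CBdAd" ∷ "BBCAb" ∷ "ABBCb" ∷ "adBc" ∷ "bdbA" ∷ "AABCa" ∷ "dBac" ∷ [])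
  ∷ ("aCa" ∷ "CCdC" ∷ "abaCB" ∷ "baBaC" ∷ "bdbcc" ∷ "AcaB" ∷ "aBcA" ∷ "BAACd" ∷ "aBaCb" ∷ "aaaCA" ∷ "ABdAC" ∷ "acAB" ∷ "AABCd" ∷ "AACdB" ∷ "bbAA" ∷ "AbbA" ∷ "cdBd" ∷ "BBcb" ∷ "abCaB" ∷ "Bc" ∷ "abaBC" ∷ "bAbA" ∷ "Caa" ∷ "aBCab" ∷ "BabaC" ∷ "bcdcb" ∷ "aabCB" ∷ "bcdbc" ∷ "ABdCA" ∷ "ABac" ∷ "AACBd" ∷ "aBabC" ∷ "baaBC" ∷ "BabCa" ∷ "caBA" ∷ "dcbbc" ∷ "ACdAB" ∷ "dcdB" ∷ "AbAb" ∷ "aBAc" ∷ "bcBB" ∷ "AAbb" ∷ "BACAd" ∷ "cABa" ∷ "aaC" ∷ "bbcdc" ∷ "acBA" ∷ "Bdcd" ∷ "dCCC" ∷ "AcBa" ∷ "cdbbc" ∷ "adCda" ∷ "cB" ∷ [])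
  ∷ ("aCAda" ∷ "BcAd" ∷ "ACCC" ∷ "bbba" ∷ "dcAB" ∷ "BdAc" ∷ "AdcB" ∷ "Cad" ∷ "AcBd" ∷ "caaa" ∷ "acccB" ∷ "bAccb" ∷ "adC" ∷ "ABdc" ∷ "cBAd" ∷ "BACAA" ∷ "aCd" ∷ "abCdB" ∷ "ABACA" ∷ "aaCdA" ∷ "cbbcA" ∷ "BAcd" ∷ "BcdA" ∷ "bccAb" ∷ "CACC" ∷ "BdcA" ∷ "AdBc" ∷ "aadCA" ∷ "aaac" ∷ "CCAC" ∷ "accBc" ∷ "Bccac" ∷ "cAdB" ∷ "acaa" ∷ "cdAB" ∷ "cBdA" ∷ "baBdC" ∷ "daC" ∷ "aaca" ∷ "dcBA" ∷ "Abbcc" ∷ "ABcd" ∷ "adBCb" ∷ "aBdCb" ∷ "Cda" ∷ "abbb" ∷ "dCa" ∷ "CCCA" ∷ "AAABC" ∷ "cABd" ∷ "bdCBa" ∷ "aaCAd" ∷ "dBcA" ∷ [])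
  ∷ ("AcBA" ∷ "adAdC" ∷ "dCd" ∷ "abABC" ∷ "cccBd" ∷ "aBBaB" ∷ "AAcB" ∷ "ACa" ∷ "adCdA" ∷ "aBCbA" ∷ "bdCBd" ∷ "aadc" ∷ "cBAA" ∷ "acda" ∷ "daac" ∷ "bbdb" ∷ "aCA" ∷ "adac" ∷ "AcAB" ∷ "dcaa" ∷ "aaBBB" ∷ "bdbb" ∷ "bbbd" ∷ "ACdad" ∷ "daca" ∷ "aBAbC" ∷ "AABc" ∷ "adca" ∷ "BCb" ∷ "acad" ∷ "ABCab" ∷ "dbbb" ∷ "aBCAb" ∷ "bCB" ∷ "caad" ∷ "BaCbA" ∷ "cACCa" ∷ "ccBcd" ∷ "abACB" ∷ "aacd" ∷ "adCAd" ∷ "bdBdC" ∷ "BabCA" ∷ "BACab" ∷ "CdBdb" ∷ "ABCba" ∷ "ABAc" ∷ "cAAB" ∷ "aCdAd" ∷ "aBBBa" ∷ "ACCac" ∷ "C" ∷ "abCBA" ∷ [])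
  ∷ ("Bcba" ∷ "bAbb" ∷ "aBdBB" ∷ "aabCa" ∷ "ABdCb" ∷ "AACda" ∷ "Abbb" ∷ "aCaba" ∷ "cbaB" ∷ "aacA" ∷ "AcBcc" ∷ "dacd" ∷ "CAd" ∷ "ACbdB" ∷ "abaaC" ∷ "cdad" ∷ "aCAdA" ∷ "adcd" ∷ "bcaB" ∷ "AcdCC" ∷ "cBccA" ∷ "AACad" ∷ "abcB" ∷ "dAC" ∷ "AcccB" ∷ "bABCd" ∷ "AdC" ∷ "aCdAA" ∷ "bbbA" ∷ "adAAC" ∷ "ACd" ∷ "AbCdB" ∷ "baBc" ∷ "CdA" ∷ "aaabC" ∷ "AdACa" ∷ "dadc" ∷ "cBab" ∷ "Bcab" ∷ "Bacb" ∷ "aBcb" ∷ "dCA" ∷ "ac" ∷ "ccaC" ∷ "aBBdB" ∷ "abCaa" ∷ "ABCdb" ∷ "Acaa" ∷ "aCAAd" ∷ "bCdAB" ∷ "bCBdA" ∷ "bbAb" ∷ "ca" ∷ [])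
  ∷ ("abCad" ∷ "BdBBd" ∷ "Adca" ∷ "adbaC" ∷ "Acad" ∷ "abadC" ∷ "dacA" ∷ "cBdb" ∷ "CAA" ∷ "Bcdb" ∷ "ccdC" ∷ "bCaad" ∷ "adbCa" ∷ "AbACB" ∷ "cd" ∷ "acdA" ∷ "Bcbd" ∷ "bcdB" ∷ "adcA" ∷ "dbcB" ∷ "CCbC" ∷ "AcACC" ∷ "aabCd" ∷ "Cdcc" ∷ "accac" ∷ "bbccb" ∷ "AAC" ∷ "aCAAA" ∷ "bCCC" ∷ "aCdba" ∷ "abdaC" ∷ "AbABC" ∷ "bdcB" ∷ "Bdcb" ∷ "bcBd" ∷ "Bdbc" ∷ "AdCdA" ∷ "dBcb" ∷ "aaCdb" ∷ "dc" ∷ "CAdAd" ∷ "Acda" ∷ "baaCd" ∷ "adabC" ∷ "ACA" ∷ "Adac" ∷ "cbbcb" ∷ "acAd" ∷ "BBB" ∷ "dAca" ∷ "cbdB" ∷ "adAc" ∷ "bdBc" ∷ [])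
  ∷ ("CAAdA" ∷ "AdBBB" ∷ "AAca" ∷ "accdc" ∷ "bdCda" ∷ "bAcB" ∷ "bCa" ∷ "BaCbb" ∷ "dAcd" ∷ "dcdA" ∷ "aabAC" ∷ "aBCbb" ∷ "cA" ∷ "ccdac" ∷ "aCb" ∷ "AACAd" ∷ "BcbA" ∷ "bcAB" ∷ "caccd" ∷ "abbCB" ∷ "Adcd" ∷ "aaCbA" ∷ "bCdad" ∷ "ccdca" ∷ "bbCaB" ∷ "acAA" ∷ "CAcc" ∷ "baBCb" ∷ "aabCA" ∷ "Cab" ∷ "cbAB" ∷ "acccd" ∷ "AdAAC" ∷ "dAdc" ∷ "cbaCC" ∷ "cBAb" ∷ "adbdC" ∷ "abC" ∷ "cdacc" ∷ "BcAb" ∷ "acdcc" ∷ "BAcb" ∷ "CdAAA" ∷ "ABcb" ∷ "Cba" ∷ "Ac" ∷ "abACa" ∷ "ccAC" ∷ "AbCaa" ∷ "bCCac" ∷ "baC" ∷ "ACAAd" ∷ "bcBA" ∷ [])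
  ∷ ("AcAd" ∷ "AABBB" ∷ "dCb" ∷ "ABABB" ∷ "AdAc" ∷ "abCdA" ∷ "AbCad" ∷ "acAcc" ∷ "cAdA" ∷ "CBCB" ∷ "acab" ∷ "aacb" ∷ "BCCB" ∷ "aabc" ∷ "abac" ∷ "aaBdB" ∷ "adaBB" ∷ "bcdCC" ∷ "cbaa" ∷ "cdAA" ∷ "AAcd" ∷ "AcdA" ∷ "bcccB" ∷ "aBdBa" ∷ "bdC" ∷ "dbC" ∷ "aadBB" ∷ "CBBC" ∷ "bCd" ∷ "ACadb" ∷ "BCBC" ∷ "aBadB" ∷ "aaBBd" ∷ "dAAc" ∷ "ccc" ∷ "BBCC" ∷ "AbdaC" ∷ "caab" ∷ "dAbaC" ∷ "badCA" ∷ "baac" ∷ "aBBda" ∷ "bccBc" ∷ "AbCda" ∷ "Cdb" ∷ "AAdc" ∷ "acccA" ∷ "Acacc" ∷ "abdAC" ∷ "aCdAb" ∷ "baca" ∷ "Cbd" ∷ "caba" ∷ [])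
  ∷ ("bcad" ∷ "dcba" ∷ "BcBaC" ∷ "CAb" ∷ "AAAc" ∷ "abCAA" ∷ "acdb" ∷ "cadb" ∷ "daBBd" ∷ "aBdBd" ∷ "bacd" ∷ "abcd" ∷ "aBCBc" ∷ "acbd" ∷ "cabd" ∷ "Accdc" ∷ "cbACC" ∷ "bcACC" ∷ "AAbCa" ∷ "aCbAA" ∷ "BBa" ∷ "cbCAC" ∷ "bAC" ∷ "abAAC" ∷ "AAcA" ∷ "bdAdC" ∷ "ACb" ∷ "aBaBA" ∷ "ABaBa" ∷ "BaB" ∷ "adcb" ∷ "AbbCB" ∷ "adbc" ∷ "CbA" ∷ "adBdB" ∷ "badc" ∷ "abdc" ∷ "AcAA" ∷ "BdBda" ∷ "dcab" ∷ "bCA" ∷ "bdac" ∷ "dabc" ∷ "dbac" ∷ "baBBB" ∷ "aBB" ∷ "BadBd" ∷ "BacBC" ∷ "aaBBA" ∷ "AbC" ∷ "cAbCC" ∷ "bdca" ∷ "cbad" ∷ [])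
  ∷ ("abbCa" ∷ "aaCbb" ∷ "aBdBA" ∷ "BBd" ∷ "bacA" ∷ "ccbC" ∷ "abcA" ∷ "bACAd" ∷ "abaCb" ∷ "bbaaC" ∷ "acbA" ∷ "dcdb" ∷ "bdcd" ∷ "aCbba" ∷ "Bcbb" ∷ "aaaaB" ∷ "dbcd" ∷ "bbcB" ∷ "dcbd" ∷ "AbdAC" ∷ "aBdAB" ∷ "aBBdA" ∷ "AACbd" ∷ "Cbcc" ∷ "AdBaB" ∷ "bAACd" ∷ "aCabb" ∷ "aabbC" ∷ "ABBad" ∷ "AbCdA" ∷ "adABB" ∷ "ababC" ∷ "cAAcc" ∷ "acAb" ∷ "Acab" ∷ "cb" ∷ "ACbdA" ∷ "bc" ∷ "Abac" ∷ "BdB" ∷ "AdaBB" ∷ "dbdc" ∷ "cdbd" ∷ "bCAAd" ∷ "abbaC" ∷ "ACAbd" ∷ "bdBBB" ∷ "bAca" ∷ "Abca" ∷ "Acba" ∷ "dBB" ∷ "aCbab" ∷ "AAbCd" ∷ [])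
  ∷ ("aCCB" ∷ "Acdb" ∷ "bdbCa" ∷ "cAdb" ∷ "bAcd" ∷ "bcdA" ∷ "Abcd" ∷ "adBaa" ∷ "BAB" ∷ "badbC" ∷ "cAbd" ∷ "aaadB" ∷ "BaCC" ∷ "abdbC" ∷ "ACbAA" ∷ "cdbA" ∷ "dbcA" ∷ "CBaC" ∷ "aCBC" ∷ "aBAAB" ∷ "dcbA" ∷ "aaBda" ∷ "abccc" ∷ "aBCC" ∷ "adCbb" ∷ "Adcb" ∷ "CBCa" ∷ "Adbc" ∷ "CaCB" ∷ "bAdc" ∷ "acbcc" ∷ "Abdc" ∷ "abCdb" ∷ "cbAd" ∷ "bAACA" ∷ "CCBa" ∷ "AbACA" ∷ "bcAd" ∷ "cdAb" ∷ "abCbd" ∷ "ABB" ∷ "bdAc" ∷ "acccb" ∷ "BBA" ∷ "CCaB" ∷ "dAcb" ∷ "CaBC" ∷ "dAbc" ∷ "bbadC" ∷ "dbAc" ∷ "BCCa" ∷ "aBdaa" ∷ "ACBcB" ∷ [])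
  ∷ ("AcbA" ∷ "baCbA" ∷ "cBBc" ∷ "CdCB" ∷ "BccB" ∷ "aaB" ∷ "BCdC" ∷ "acaBC" ∷ "ABAdB" ∷ "abCbA" ∷ "BCCd" ∷ "CBdC" ∷ "aBdad" ∷ "AbCab" ∷ "adBda" ∷ "CBCd" ∷ "CCdB" ∷ "bbC" ∷ "BacaC" ∷ "aCaBc" ∷ "dCCB" ∷ "CdBC" ∷ "aadBd" ∷ "AcAb" ∷ "BcBc" ∷ "AAcb" ∷ "bbACa" ∷ "Baa" ∷ "AbCba" ∷ "AbAc" ∷ "adBad" ∷ "acBaC" ∷ "abCAb" ∷ "CCBd" ∷ "aBBab" ∷ "cBcB" ∷ "bccdc" ∷ "cccdb" ∷ "dCBC" ∷ "aBCac" ∷ "aaaBA" ∷ "aCAbb" ∷ "acaCB" ∷ "BBcc" ∷ "Cbb" ∷ "bAcA" ∷ "AABBd" ∷ "bCb" ∷ "BdAAB" ∷ "aBa" ∷ "cbAA" ∷ "abbAC" ∷ "BdCC" ∷ [])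
  ∷ ("BabdB" ∷ "Bda" ∷ "abdBB" ∷ "ABCC" ∷ "BCCA" ∷ "BCdac" ∷ "aCdcB" ∷ "cbab" ∷ "aBd" ∷ "adcBC" ∷ "Acbcc" ∷ "adCBc" ∷ "AbCdb" ∷ "aCBdc" ∷ "CBCA" ∷ "CCAB" ∷ "BBdab" ∷ "Bad" ∷ "AdaaB" ∷ "acbb" ∷ "AAABB" ∷ "aaaaa" ∷ "cbba" ∷ "bcab" ∷ "bacb" ∷ "bCbdA" ∷ "babc" ∷ "bbac" ∷ "aadBA" ∷ "aBadA" ∷ "AdbbC" ∷ "acdCB" ∷ "BBabd" ∷ "ACCB" ∷ "BACC" ∷ "cabb" ∷ "dBa" ∷ "bbca" ∷ "bcba" ∷ "BCAC" ∷ "abcb" ∷ "aCBcd" ∷ "abbc" ∷ "acBCd" ∷ "adB" ∷ "daB" ∷ "aadAB" ∷ "aaBdA" ∷ "BABAA" ∷ "CBAC" ∷ "CCBA" ∷ "ACBC" ∷ "ABAAB" ∷ [])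
  ∷ ("aBA" ∷ "ACAbb" ∷ "AcaCB" ∷ "bdcb" ∷ "acABC" ∷ "bdbc" ∷ "cdbb" ∷ "aCCa" ∷ "BACac" ∷ "ABa" ∷ "CaaC" ∷ "AbbAC" ∷ "ACacB" ∷ "aCBcA" ∷ "dbcb" ∷ "AbACb" ∷ "dbbc" ∷ "acBCA" ∷ "B" ∷ "CaCa" ∷ "AcaBC" ∷ "baBBA" ∷ "aaCC" ∷ "aBBAb" ∷ "bdBBd" ∷ "ABdad" ∷ "aCABc" ∷ "AdBda" ∷ "ACbbA" ∷ "AbbCA" ∷ "AAbbC" ∷ "bbCAA" ∷ "bcdb" ∷ "aBCAc" ∷ "AbaBB" ∷ "dBd" ∷ "cBC" ∷ "bbcd" ∷ "CBc" ∷ "bcbd" ∷ "AABaa" ∷ "CCaa" ∷ "aaada" ∷ "AdBad" ∷ "AcBaC" ∷ "AbCAb" ∷ "dcbb" ∷ "ABBab" ∷ "bAbAC" ∷ "bbAAC" ∷ "aadaa" ∷ "aCaC" ∷ "acBAC" ∷ [])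
  ∷ ("baCbb" ∷ "dBA" ∷ "caBc" ∷ "aabaB" ∷ "AcdCB" ∷ "bbcA" ∷ "aCbbb" ∷ "bbaCb" ∷ "dCCa" ∷ "bcbA" ∷ "aBcc" ∷ "abCbb" ∷ "cBac" ∷ "Abcb" ∷ "abbCb" ∷ "Abbc" ∷ "abaBa" ∷ "AdB" ∷ "AAdaB" ∷ "dAB" ∷ "BdA" ∷ "cbAb" ∷ "cBca" ∷ "daCC" ∷ "accB" ∷ "abaaB" ∷ "aCdC" ∷ "AABda" ∷ "aBaba" ∷ "Bcac" ∷ "aCCd" ∷ "CdCa" ∷ "bcAb" ∷ "adBAA" ∷ "ABd" ∷ "cacB" ∷ "bAbc" ∷ "aaCac" ∷ "bbAc" ∷ "Bcca" ∷ "CACCC" ∷ "ccaB" ∷ "aCaac" ∷ "AABad" ∷ "acBc" ∷ "Acbb" ∷ "Bacc" ∷ "aaa" ∷ "aBdAA" ∷ "bAdBB" ∷ "CadC" ∷ "cbbA" ∷ "BAd" ∷ [])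
  ∷ ("aacdC" ∷ "badBa" ∷ "aCdca" ∷ "CbCB" ∷ "aad" ∷ "ACAcB" ∷ "ACCa" ∷ "cBcd" ∷ "AAABa" ∷ "acadC" ∷ "ccdB" ∷ "bbdbC" ∷ "dBcc" ∷ "Bcdc" ∷ "aCacd" ∷ "AdAdB" ∷ "bCBC" ∷ "AAB" ∷ "aBdba" ∷ "aBabd" ∷ "bbccc" ∷ "CC" ∷ "ABBAb" ∷ "abdBa" ∷ "BCCb" ∷ "cdcB" ∷ "aCAC" ∷ "ccBd" ∷ "dCdC" ∷ "aaCdc" ∷ "CACa" ∷ "abadB" ∷ "cBdc" ∷ "bCbdb" ∷ "acdaC" ∷ "BAA" ∷ "bdaaB" ∷ "AACBc" ∷ "AcACB" ∷ "CaCA" ∷ "aabdB" ∷ "ada" ∷ "bccbc" ∷ "acdCa" ∷ "aCCA" ∷ "cdBc" ∷ "dcBc" ∷ "BCbC" ∷ "abaBd" ∷ "daa" ∷ "ACaC" ∷ "bCCB" ∷ "ABA" ∷ [])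
  ∷ ("Adaad" ∷ "baB" ∷ "aCAca" ∷ "ccAB" ∷ "ACbbb" ∷ "CCAd" ∷ "cdCad" ∷ "aBAba" ∷ "dad" ∷ "abdBd" ∷ "aabAB" ∷ "cABc" ∷ "abCBc" ∷ "BccA" ∷ "AbaBa" ∷ "aaBAb" ∷ "CdAC" ∷ "AdCC" ∷ "AABdA" ∷ "CAdC" ∷ "aCdcd" ∷ "baCBc" ∷ "AccB" ∷ "CACd" ∷ "ACdC" ∷ "dACC" ∷ "CCdA" ∷ "BAcc" ∷ "ACCd" ∷ "adAda" ∷ "Bab" ∷ "cBAc" ∷ "AAABd" ∷ "BAAAd" ∷ "CdCA" ∷ "Cac" ∷ "caC" ∷ "Adada" ∷ "ccBA" ∷ "Bdadb" ∷ "ACaac" ∷ "adcdC" ∷ "AcBc" ∷ "aCBcb" ∷ "cAcB" ∷ "a" ∷ "BcAc" ∷ "aBCbc" ∷ "dCCA" ∷ "acdCd" ∷ "AABAd" ∷ "cBcA" ∷ "aBdbd" ∷ [])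
  ∷ ("d" ∷ "adCAc" ∷ "abdBA" ∷ "adcAC" ∷ "aCdAc" ∷ "aBdAb" ∷ "cbdBC" ∷ "dBdbd" ∷ "ABadb" ∷ "AcaCd" ∷ "ACacd" ∷ "bcbb" ∷ "caac" ∷ "AAAAB" ∷ "acAdC" ∷ "ABabd" ∷ "BdcbC" ∷ "AACC" ∷ "abAdB" ∷ "AbdBa" ∷ "abdAB" ∷ "adA" ∷ "ACAC" ∷ "aBAdb" ∷ "aCdcA" ∷ "Cdc" ∷ "BcbdC" ∷ "AbadB" ∷ "AbdaB" ∷ "BBBC" ∷ "acac" ∷ "aabaa" ∷ "bbcb" ∷ "bCBcd" ∷ "bbbc" ∷ "abABd" ∷ "bdB" ∷ "Ada" ∷ "badAB" ∷ "adbAB" ∷ "acca" ∷ "ACdac" ∷ "ccdCC" ∷ "CAcad" ∷ "adBAb" ∷ "aCAdc" ∷ "Bdb" ∷ "aacc" ∷ "abaaa" ∷ "cdC" ∷ "aaaab" ∷ "ACdca" ∷ "ABdab" ∷ [])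
  ∷ ("AAdad" ∷ "CCab" ∷ "bAB" ∷ "dcca" ∷ "aCAAc" ∷ "adAAd" ∷ "baCC" ∷ "BAb" ∷ "BBBca" ∷ "CabC" ∷ "dacc" ∷ "BCAbc" ∷ "ACdcd" ∷ "BCbAc" ∷ "aBAAb" ∷ "acdc" ∷ "dAd" ∷ "CAc" ∷ "BBcBa" ∷ "cAC" ∷ "acACA" ∷ "AdAda" ∷ "CbaC" ∷ "abCC" ∷ "aadab" ∷ "aabad" ∷ "aCCb" ∷ "AACac" ∷ "AAcaC" ∷ "cdCdA" ∷ "AdBdb" ∷ "CbCa" ∷ "cadc" ∷ "aaadb" ∷ "ccda" ∷ "bCaC" ∷ "adbaa" ∷ "A" ∷ "cdac" ∷ "CaCb" ∷ "aaabd" ∷ "AcdCd" ∷ "aBBBc" ∷ "accd" ∷ "bCCa" ∷ "CAdcd" ∷ "dcac" ∷ "ACAca" ∷ "cdca" ∷ "aCbC" ∷ "ccad" ∷ "abdaa" ∷ "adcc" ∷ [])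
  ∷ ("baBab" ∷ "bdBAA" ∷ "dbCC" ∷ "cbaaC" ∷ "aacbC" ∷ "AdA" ∷ "cdcd" ∷ "ABAdb" ∷ "ACdcA" ∷ "aBabb" ∷ "bCaac" ∷ "cbcB" ∷ "bcBc" ∷ "AcdCA" ∷ "Acac" ∷ "baa" ∷ "dAA" ∷ "accA" ∷ "bdABA" ∷ "acaCb" ∷ "AAbdB" ∷ "CbdC" ∷ "CdbC" ∷ "AdbAB" ∷ "Acca" ∷ "CbCd" ∷ "BdBcB" ∷ "bCbbb" ∷ "dCbC" ∷ "cBcb" ∷ "AABdb" ∷ "cc" ∷ "Abaaa" ∷ "AAcdC" ∷ "aab" ∷ "aCacb" ∷ "aaCbc" ∷ "AAd" ∷ "aCbac" ∷ "abCac" ∷ "bdCC" ∷ "cAca" ∷ "acabC" ∷ "Bccb" ∷ "cBdBB" ∷ "bccB" ∷ "bbaaB" ∷ "bCdC" ∷ "CCbd" ∷ "aba" ∷ "acAc" ∷ "bCCd" ∷ "CdCb" ∷ [])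
  ∷ ("BBcAB" ∷ "adb" ∷ "bcaCd" ∷ "adCbc" ∷ "abcdC" ∷ "AAA" ∷ "aCbcd" ∷ "dba" ∷ "abd" ∷ "BaBC" ∷ "bACC" ∷ "Accd" ∷ "acdCb" ∷ "aadbA" ∷ "CBBa" ∷ "bCAC" ∷ "CbAC" ∷ "ACbC" ∷ "baCdc" ∷ "aBCB" ∷ "Adcc" ∷ "bbdaB" ∷ "AbABA" ∷ "CBaB" ∷ "adcbC" ∷ "ccAd" ∷ "AdAAd" ∷ "CCbA" ∷ "dccA" ∷ "cdAc" ∷ "bda" ∷ "aabAd" ∷ "bcdCa" ∷ "bCCA" ∷ "CbCA" ∷ "acdbC" ∷ "Acdc" ∷ "aBBC" ∷ "acbCd" ∷ "CaBB" ∷ "aCBB" ∷ "AcACA" ∷ "BBCa" ∷ "CAbC" ∷ "AbCC" ∷ "dab" ∷ "bad" ∷ "ACCb" ∷ "BBBcA" ∷ "cdcA" ∷ "CCAb" ∷ "BCBa" ∷ "aabdA" ∷ [])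
  ∷ ("abA" ∷ "cAAc" ∷ "badAd" ∷ "baCAc" ∷ "aBaBc" ∷ "AAdAA" ∷ "AccA" ∷ "acbCA" ∷ "AcaCb" ∷ "dCBB" ∷ "BAbba" ∷ "BaBac" ∷ "BCBd" ∷ "bACac" ∷ "aBBac" ∷ "cAbCa" ∷ "acAbC" ∷ "Bdbdb" ∷ "abbAB" ∷ "aacBB" ∷ "AAcc" ∷ "cAcA" ∷ "CAcab" ∷ "b" ∷ "aBBca" ∷ "Cbc" ∷ "aBAbb" ∷ "CBdB" ∷ "AbCac" ∷ "aCbAc" ∷ "dbd" ∷ "aaBcB" ∷ "abdAd" ∷ "abCAc" ∷ "ccAA" ∷ "BdCB" ∷ "AdAAA" ∷ "aBacB" ∷ "Aba" ∷ "AcAc" ∷ "acBBa" ∷ "dBCB" ∷ "acbAC" ∷ "BBdC" ∷ "CBBd" ∷ "cdbdC" ∷ "cbC" ∷ "BBCd" ∷ "BCdB" ∷ "acBaB" ∷ "BabbA" ∷ "aaBBc" ∷ "Cdcdb" ∷ [])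
  ∷ ("bdBAb" ∷ "bCAdc" ∷ "AdcbC" ∷ "bacc" ∷ "bbaaa" ∷ "adBcB" ∷ "baaab" ∷ "BBAC" ∷ "BCBA" ∷ "bAd" ∷ "abcc" ∷ "aBBcd" ∷ "BABC" ∷ "abaab" ∷ "dAb" ∷ "ABBC" ∷ "CABB" ∷ "CbdAc" ∷ "ACBB" ∷ "CBBA" ∷ "adbAA" ∷ "baaba" ∷ "accb" ∷ "AAdab" ∷ "acbc" ∷ "BBCA" ∷ "BCAB" ∷ "aaabb" ∷ "ccab" ∷ "cacb" ∷ "bdA" ∷ "cabc" ∷ "Adb" ∷ "aCCCB" ∷ "AdCbc" ∷ "AbcdC" ∷ "aBBdc" ∷ "CBAB" ∷ "AAdba" ∷ "Abd" ∷ "babaa" ∷ "badAA" ∷ "cbca" ∷ "ccba" ∷ "dbA" ∷ "bAbdB" ∷ "adcBB" ∷ "BACB" ∷ "abdAA" ∷ "bcca" ∷ "ABCB" ∷ "aCCBC" ∷ "aabab" ∷ [])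
  ∷ ("aBCa" ∷ "CaBa" ∷ "bAA" ∷ "abdab" ∷ "dccb" ∷ "AcBaB" ∷ "dcbc" ∷ "BBc" ∷ "bccd" ∷ "AbA" ∷ "BCaa" ∷ "aBcAB" ∷ "abadb" ∷ "cdcb" ∷ "bCbC" ∷ "cdbc" ∷ "abAAA" ∷ "bdcc" ∷ "aCaB" ∷ "cbdc" ∷ "aaBC" ∷ "AcaBB" ∷ "CbbC" ∷ "ABBac" ∷ "bbaad" ∷ "AcAbC" ∷ "BAbAb" ∷ "AbbAB" ∷ "cBB" ∷ "BAAbb" ∷ "CAAcb" ∷ "BcABa" ∷ "AAb" ∷ "bcdc" ∷ "AACbc" ∷ "acBAB" ∷ "ACAbc" ∷ "aabdb" ∷ "ACbAc" ∷ "aBBAc" ∷ "BcB" ∷ "bbCC" ∷ "ccdb" ∷ "aadbb" ∷ "aBaC" ∷ "dbcc" ∷ "aBcBA" ∷ "cbcd" ∷ "AdbdA" ∷ "ccbd" ∷ "AdAdb" ∷ "AcbAC" ∷ "CbCb" ∷ [])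
  ∷ ("bccA" ∷ "cAcb" ∷ "CdaB" ∷ "cAbc" ∷ "adCB" ∷ "cbAc" ∷ "acaaB" ∷ "abAba" ∷ "dBaC" ∷ "aacaB" ∷ "BcdAB" ∷ "CBda" ∷ "aBdC" ∷ "BdaC" ∷ "bAcc" ∷ "abcbC" ∷ "aBCd" ∷ "bab" ∷ "CaBd" ∷ "daCB" ∷ "BCda" ∷ "ACBCC" ∷ "adBC" ∷ "aaaBc" ∷ "badbd" ∷ "cbcA" ∷ "dCBa" ∷ "CBad" ∷ "Abcc" ∷ "ccbA" ∷ "bdAAA" ∷ "Abaab" ∷ "bba" ∷ "bcAc" ∷ "aCBd" ∷ "dCaB" ∷ "BCad" ∷ "daBC" ∷ "aBaca" ∷ "adbdb" ∷ "Accb" ∷ "BadC" ∷ "Acbc" ∷ "aaBca" ∷ "AcBdB" ∷ "abb" ∷ "CdBa" ∷ "abCbc" ∷ "acbCb" ∷ "ABcBd" ∷ "acaBa" ∷ "ACCCB" ∷ "ccAb" ∷ [])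
  ∷ ("abbAd" ∷ "ACaB" ∷ "CdBd" ∷ "BC" ∷ "adcBa" ∷ "CCBc" ∷ "bCBB" ∷ "BdCd" ∷ "cBCC" ∷ "cdCbb" ∷ "aaCCC" ∷ "aBadc" ∷ "BACa" ∷ "aBcda" ∷ "aadcB" ∷ "dCBd" ∷ "aBCA" ∷ "aCAB" ∷ "AcBAB" ∷ "acBad" ∷ "bdb" ∷ "BaCA" ∷ "ABBAc" ∷ "abAdb" ∷ "Abbda" ∷ "bCbcd" ∷ "dbb" ∷ "bbd" ∷ "cABBA" ∷ "CABa" ∷ "abAbd" ∷ "bcdCb" ∷ "badbA" ∷ "BBCb" ∷ "aadBc" ∷ "abdbA" ∷ "ABCa" ∷ "adBac" ∷ "CB" ∷ "aBacd" ∷ "Abbad" ∷ "cadBa" ∷ "ABBcA" ∷ "AABBc" ∷ "bCdcb" ∷ "ACBa" ∷ "dBdC" ∷ "acdaB" ∷ "Abadb" ∷ "aaBcd" ∷ "dBCd" ∷ "aBAC" ∷ "aCBA" ∷ [])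
  ∷ ("ACBd" ∷ "bcAbC" ∷ "cbCAb" ∷ "bbbAB" ∷ "CAdB" ∷ "Adbdb" ∷ "CdAB" ∷ "CBdA" ∷ "bAb" ∷ "Bca" ∷ "abcBB" ∷ "Abb" ∷ "Adbbd" ∷ "dBAC" ∷ "aaaC" ∷ "bAdbd" ∷ "aacBA" ∷ "aBdcd" ∷ "dABC" ∷ "cBa" ∷ "bbcAC" ∷ "CABd" ∷ "acB" ∷ "aaCa" ∷ "aCCdC" ∷ "AcaaB" ∷ "AbAba" ∷ "bcbAC" ∷ "caB" ∷ "aaBcA" ∷ "ccaBC" ∷ "ABdC" ∷ "dCAB" ∷ "BdAC" ∷ "Caaa" ∷ "ABCd" ∷ "ACdB" ∷ "abbAA" ∷ "bbA" ∷ "CBAd" ∷ "BACd" ∷ "AdBC" ∷ "aBc" ∷ "BCdA" ∷ "abAbA" ∷ "aCaa" ∷ "Bdadc" ∷ "ABaac" ∷ "BBcab" ∷ "BBacb" ∷ "bcaBB" ∷ "BdCA" ∷ "Bac" ∷ [])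
  ∷ ("aCad" ∷ "cBd" ∷ "ACAB" ∷ "bCCCB" ∷ "AcBad" ∷ "aadC" ∷ "Bdc" ∷ "acBAd" ∷ "AbAdb" ∷ "aaCd" ∷ "cABad" ∷ "BACA" ∷ "ccbb" ∷ "bcBBd" ∷ "aBAcd" ∷ "BBBB" ∷ "bdcBB" ∷ "aCACC" ∷ "aBdcA" ∷ "dBc" ∷ "AbdbA" ∷ "aaaac" ∷ "dCaa" ∷ "AACB" ∷ "ABacd" ∷ "acAdB" ∷ "CABA" ∷ "acdAB" ∷ "BCAA" ∷ "BBcdb" ∷ "adaC" ∷ "Caad" ∷ "adcBA" ∷ "bbcc" ∷ "Bcd" ∷ "cbbc" ∷ "ABAC" ∷ "cdB" ∷ "aabbb" ∷ "adCa" ∷ "aCCCA" ∷ "AABC" ∷ "acABd" ∷ "AbdAb" ∷ "CAAB" ∷ "bccb" ∷ "BAAC" ∷ "bcbc" ∷ "CCC" ∷ "abbba" ∷ "adcAB" ∷ "aBdAc" ∷ "dcB" ∷ [])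
  ∷ ("adaac" ∷ "BaCb" ∷ "aaCA" ∷ "aadac" ∷ "cAB" ∷ "adcaa" ∷ "CCCAd" ∷ "dCad" ∷ "caCC" ∷ "Cdad" ∷ "adaca" ∷ "bCaB" ∷ "ABc" ∷ "baBC" ∷ "aBCb" ∷ "ACaa" ∷ "BCab" ∷ "adbbb" ∷ "cBdAd" ∷ "abCB" ∷ "acaad" ∷ "bAcBB" ∷ "AABac" ∷ "CAccB" ∷ "BabC" ∷ "aaacd" ∷ "BBcAb" ∷ "AcaBA" ∷ "bcBAB" ∷ "CACCd" ∷ "AdcdB" ∷ "BCba" ∷ "BAc" ∷ "acAAB" ∷ "AAAbb" ∷ "CCdCA" ∷ "CCac" ∷ "aC" ∷ "ccBAC" ∷ "cBA" ∷ "ABdcd" ∷ "adCd" ∷ "AAcBa" ∷ "ccABC" ∷ "dCda" ∷ "AcB" ∷ "Ca" ∷ "ACCdC" ∷ "baCB" ∷ "bbdab" ∷ "aaadc" ∷ "acBAA" ∷ "BcA" ∷ [])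
  ∷ ("abbbA" ∷ "bbcbC" ∷ "Cd" ∷ "bCdB" ∷ "abaBc" ∷ "aCdA" ∷ "cAABd" ∷ "dACa" ∷ "bdBC" ∷ "acBab" ∷ "aBcab" ∷ "aBacb" ∷ "aaBcb" ∷ "adCA" ∷ "aac" ∷ "accaC" ∷ "ccBc" ∷ "dadac" ∷ "BCdb" ∷ "caa" ∷ "bCBd" ∷ "AcBdA" ∷ "cdABA" ∷ "AdaC" ∷ "aca" ∷ "BCbd" ∷ "abAbb" ∷ "CCdc" ∷ "dBCb" ∷ "BdCb" ∷ "ACda" ∷ "bbb" ∷ "AdCa" ∷ "dbCB" ∷ "aaacA" ∷ "cBcc" ∷ "adacd" ∷ "aCAd" ∷ "CbdB" ∷ "CAda" ∷ "acdad" ∷ "AACCC" ∷ "aadcd" ∷ "bdCB" ∷ "cdCC" ∷ "AAdcB" ∷ "ACad" ∷ "aabcB" ∷ "adAC" ∷ "cccB" ∷ "cbaaB" ∷ "dC" ∷ "BdbC" ∷ [])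
  ∷ ("ABCb" ∷ "cad" ∷ "bbAbd" ∷ "adacA" ∷ "BCAb" ∷ "aCAA" ∷ "CbAB" ∷ "accdC" ∷ "Bcadb" ∷ "bdBac" ∷ "bACB" ∷ "acd" ∷ "dCAd" ∷ "aBcbd" ∷ "abcdB" ∷ "aadcA" ∷ "adbcB" ∷ "aCCbC" ∷ "cACC" ∷ "AcAAB" ∷ "CdAd" ∷ "BBBa" ∷ "bCCaC" ∷ "AC" ∷ "bCBA" ∷ "abCCC" ∷ "dAdC" ∷ "AdCd" ∷ "bABC" ∷ "abdcB" ∷ "BBaB" ∷ "abcBd" ∷ "AACa" ∷ "dCdA" ∷ "BCbA" ∷ "baCCC" ∷ "adc" ∷ "AcBAA" ∷ "cda" ∷ "Adaac" ∷ "Abbdb" ∷ "CA" ∷ "dac" ∷ "AAcAB" ∷ "aacAd" ∷ "aBBB" ∷ "BaBB" ∷ "acbdB" ∷ "aadAc" ∷ "abdBc" ∷ "BAbC" ∷ "AAABc" ∷ "dca" ∷ [])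
  ∷ ("abCa" ∷ "bcaBA" ∷ "adAcd" ∷ "adcdA" ∷ "Caba" ∷ "BBBd" ∷ "acA" ∷ "bbcBB" ∷ "aaCb" ∷ "ACAd" ∷ "aBcbA" ∷ "baaC" ∷ "Acdad" ∷ "CAdA" ∷ "dcd" ∷ "AbcaB" ∷ "bAcBa" ∷ "dbcdB" ∷ "Bdbcd" ∷ "bcB" ∷ "AdAC" ∷ "bCCdC" ∷ "cdbdB" ∷ "aCab" ∷ "CdAA" ∷ "AbbbA" ∷ "dAAC" ∷ "AACd" ∷ "dbCCC" ∷ "acBAb" ∷ "ACdA" ∷ "aabC" ∷ "cdBdb" ∷ "aBcAb" ∷ "AcBab" ∷ "aBAcb" ∷ "ABacb" ∷ "Bcb" ∷ "aCba" ∷ "c" ∷ "AccaC" ∷ "BBdB" ∷ "bCaa" ∷ "Bdbdc" ∷ "abaC" ∷ "CAAd" ∷ "abcBA" ∷ "dacAd" ∷ "dBBB" ∷ "Aca" ∷ "ABcba" ∷ "AbAbb" ∷ "BdBB" ∷ [])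
  ∷ ("aBCCB" ∷ "aaabc" ∷ "ACAA" ∷ "baCd" ∷ "AccdC" ∷ "BAcdb" ∷ "dbCa" ∷ "acdAA" ∷ "Acd" ∷ "cdA" ∷ "ABcbd" ∷ "AbcdB" ∷ "dcA" ∷ "adbC" ∷ "daCb" ∷ "aCBBC" ∷ "abCd" ∷ "Cadb" ∷ "ccac" ∷ "bcAdB" ∷ "AAAC" ∷ "CAAA" ∷ "accc" ∷ "Cdba" ∷ "bdaC" ∷ "acaab" ∷ "AbdcB" ∷ "ABdcb" ∷ "ccca" ∷ "dCab" ∷ "BCBCa" ∷ "bCda" ∷ "aCdb" ∷ "Adc" ∷ "bCCCA" ∷ "cacc" ∷ "bcABd" ∷ "dabC" ∷ "AACA" ∷ "aCbd" ∷ "acaba" ∷ "cAd" ∷ "ABBB" ∷ "adCb" ∷ "BABB" ∷ "dAc" ∷ "Cbda" ∷ "bCad" ∷ "bAcBd" ∷ "acAdA" ∷ "dbaC" ∷ "aacab" ∷ "badC" ∷ [])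
  ∷ ("AcA" ∷ "badca" ∷ "Cb" ∷ "bacad" ∷ "BaBa" ∷ "aBaB" ∷ "aadcb" ∷ "bbCB" ∷ "aadbc" ∷ "aCbA" ∷ "BcBBc" ∷ "abadc" ∷ "aabdc" ∷ "cAA" ∷ "ACAcc" ∷ "adcab" ∷ "abCA" ∷ "ACab" ∷ "adabc" ∷ "cccd" ∷ "bABAc" ∷ "aaBB" ∷ "CBBdC" ∷ "AcBAb" ∷ "dbdC" ∷ "bC" ∷ "CBBCd" ∷ "abdca" ∷ "cdcc" ∷ "bdCd" ∷ "adcba" ∷ "AABcb" ∷ "aCAb" ∷ "AAc" ∷ "bACa" ∷ "BBaa" ∷ "acadb" ∷ "BAbAc" ∷ "AbaC" ∷ "abacd" ∷ "aabcd" ∷ "bdaac" ∷ "aacbd" ∷ "baCA" ∷ "ccdc" ∷ "bAcAB" ∷ "AbAcB" ∷ "AbCa" ∷ "bbdbb" ∷ "aBBa" ∷ "AdcdA" ∷ "abAC" ∷ "BCbb" ∷ [])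
  ∷ ("bca" ∷ "cba" ∷ "adBB" ∷ "dCAb" ∷ "AbCd" ∷ "Babbc" ∷ "ABCBC" ∷ "BadB" ∷ "aBBd" ∷ "abacA" ∷ "Accc" ∷ "aabcA" ∷ "bdacd" ∷ "bCAd" ∷ "BACBC" ∷ "aacbA" ∷ "adcdb" ∷ "BBda" ∷ "badcd" ∷ "aBcbb" ∷ "ACdb" ∷ "adbcd" ∷ "cccA" ∷ "adcbd" ∷ "bdAC" ∷ "CdAb" ∷ "dACb" ∷ "ACbd" ∷ "aCbcc" ∷ "dBaB" ∷ "BCBCA" ∷ "AdCb" ∷ "dadbc" ∷ "BBad" ∷ "bCdA" ∷ "Bacbb" ∷ "cAcc" ∷ "AcAdA" ∷ "aacAb" ∷ "cab" ∷ "acb" ∷ "CbdA" ∷ "abc" ∷ "bac" ∷ "aBdB" ∷ "daBB" ∷ "adbdc" ∷ "acdbd" ∷ "AcdAA" ∷ "dAbC" ∷ "CAbd" ∷ "Bcabb" ∷ "BdBa" ∷ [])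
  ∷ ("aBBA" ∷ "AAbC" ∷ "adAcb" ∷ "dBBd" ∷ "adAbc" ∷ "Abcad" ∷ "adbAc" ∷ "aBCCa" ∷ "ACAb" ∷ "CBcB" ∷ "bCAA" ∷ "cdb" ∷ "Acadb" ∷ "acAdb" ∷ "BdBd" ∷ "BcBC" ∷ "bcd" ∷ "BCBc" ∷ "cbd" ∷ "Acabd" ∷ "acAbd" ∷ "bdbcB" ∷ "aBaCC" ∷ "cadbA" ∷ "CbAA" ∷ "ABBa" ∷ "adbcA" ∷ "AbAC" ∷ "bAAC" ∷ "cBCB" ∷ "adcbA" ∷ "AACb" ∷ "BaBA" ∷ "aaBCC" ∷ "ABaB" ∷ "dcb" ∷ "aCBCa" ∷ "dbc" ∷ "ACbA" ∷ "dBdB" ∷ "Abadc" ∷ "bdc" ∷ "AAcAA" ∷ "acbAd" ∷ "Adcab" ∷ "AbCA" ∷ "bACA" ∷ "cBBC" ∷ "acdAb" ∷ "bacAd" ∷ "BB" ∷ "abdAc" ∷ "bcbdB" ∷ [])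
  ∷ ("aCCBd" ∷ "bbaC" ∷ "acBcB" ∷ "bbcBA" ∷ "AbAca" ∷ "Baaa" ∷ "AAcba" ∷ "AdBB" ∷ "Cbab" ∷ "bbAcB" ∷ "bbCa" ∷ "aCbb" ∷ "BdBA" ∷ "ABBd" ∷ "abCb" ∷ "AccbC" ∷ "bcA" ∷ "acbAA" ∷ "baCb" ∷ "aBdCC" ∷ "cbA" ∷ "Adcdb" ∷ "acBBc" ∷ "Cbba" ∷ "aBccB" ∷ "aaaB" ∷ "aBCdC" ∷ "AbbcB" ∷ "BAdB" ∷ "bacAA" ∷ "BdAB" ∷ "BBdA" ∷ "BcbAb" ∷ "bCab" ∷ "bcbAB" ∷ "aCBCd" ∷ "Cabb" ∷ "abbC" ∷ "cbbAB" ∷ "bcBAb" ∷ "dABB" ∷ "babC" ∷ "BCdCa" ∷ "cAb" ∷ "aBcBc" ∷ "Acb" ∷ "BcacB" ∷ "Abc" ∷ "bCba" ∷ "bAc" ∷ "BBcca" ∷ "Adbdc" ∷ "Acdbd" ∷ [])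
  ∷ ("AcbAd" ∷ "aCBCA" ∷ "Cbdb" ∷ "cbAAd" ∷ "aBad" ∷ "daaB" ∷ "bCbd" ∷ "AABB" ∷ "Cdbb" ∷ "cccb" ∷ "ABBA" ∷ "ccbc" ∷ "AdAcb" ∷ "ababc" ∷ "abbac" ∷ "BdcBc" ∷ "AdbAc" ∷ "dbbC" ∷ "Bdaa" ∷ "baacb" ∷ "CCB" ∷ "BABA" ∷ "acabb" ∷ "adBa" ∷ "abbca" ∷ "abcba" ∷ "Baad" ∷ "dBaa" ∷ "ABAB" ∷ "aabbc" ∷ "AcAbd" ∷ "aadB" ∷ "adaB" ∷ "bdbC" ∷ "BdBcc" ∷ "AcdbA" ∷ "bbCd" ∷ "aCCBA" ∷ "CBC" ∷ "BAAB" ∷ "AdcbA" ∷ "aBda" ∷ "bccc" ∷ "BCC" ∷ "dCbb" ∷ "AAdcb" ∷ "ACBCa" ∷ "dbCb" ∷ "aaBd" ∷ "daBa" ∷ "cbcc" ∷ "AAbdc" ∷ "bCdb" ∷ [])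
  ∷ ("bAcAA" ∷ "dBda" ∷ "CbbA" ∷ "bbCA" ∷ "AbbC" ∷ "bdabc" ∷ "CaBc" ∷ "AdCCB" ∷ "baBB" ∷ "adBd" ∷ "acBC" ∷ "abbcd" ∷ "aCBc" ∷ "abcbd" ∷ "ABaa" ∷ "aCCaa" ∷ "CBac" ∷ "dBad" ∷ "cBaC" ∷ "bCAb" ∷ "adcbb" ∷ "BBab" ∷ "AcBcB" ∷ "bcadb" ∷ "CCBdA" ∷ "CbAb" ∷ "BCac" ∷ "aaBA" ∷ "CAbb" ∷ "caCB" ∷ "abdcb" ∷ "ACbb" ∷ "abdbc" ∷ "acdbb" ∷ "AbCb" ∷ "BcAcB" ∷ "Ba" ∷ "aCaaC" ∷ "bbAC" ∷ "CacB" ∷ "AAcbA" ∷ "adbcb" ∷ "bACb" ∷ "adbbc" ∷ "dadB" ∷ "aB" ∷ "aCaCa" ∷ "caBC" ∷ "badbc" ∷ "bCbA" ∷ "ABCCd" ∷ "ACBdC" ∷ "Bdad" ∷ [])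
  ∷ ("aBAd" ∷ "Abbac" ∷ "adBA" ∷ "BadA" ∷ "BACAC" ∷ "cdCB" ∷ "abbcA" ∷ "BCdc" ∷ "ABACC" ∷ "dABa" ∷ "AdBa" ∷ "aaBcc" ∷ "Abcba" ∷ "cBdC" ∷ "bcb" ∷ "CBcd" ∷ "bbc" ∷ "cBCd" ∷ "dB" ∷ "AdaB" ∷ "adAB" ∷ "aBdA" ∷ "acbAb" ∷ "cdBC" ∷ "adaCC" ∷ "aaccB" ∷ "bbAca" ∷ "aaCdC" ∷ "ABda" ∷ "bdBB" ∷ "aBcac" ∷ "BcdC" ∷ "aCdCa" ∷ "CdcB" ∷ "Acbab" ∷ "Bd" ∷ "dcBC" ∷ "abAbc" ∷ "dCBc" ∷ "abbAc" ∷ "CBdc" ∷ "ACBCA" ∷ "accaB" ∷ "bdcdb" ∷ "ABad" ∷ "aacBc" ∷ "cbb" ∷ "aBacc" ∷ "aaaa" ∷ "Acbba" ∷ "Abcab" ∷ "aCadC" ∷ "acbbA" ∷ [])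
  ∷ ("cBAC" ∷ "BA" ∷ "bCCaB" ∷ "bdAcb" ∷ "Abdcb" ∷ "cABC" ∷ "aaad" ∷ "CAcB" ∷ "CCa" ∷ "acBcd" ∷ "AABa" ∷ "ACaaC" ∷ "accdB" ∷ "BaCbC" ∷ "CBcA" ∷ "aBcdc" ∷ "bbcdA" ∷ "dAdB" ∷ "cBCA" ∷ "AB" ∷ "dBdA" ∷ "bcAbd" ∷ "cAbdb" ∷ "aCC" ∷ "BBAb" ∷ "cbAdb" ∷ "aBCCb" ∷ "CABc" ∷ "aaCAC" ∷ "accBd" ∷ "adCdC" ∷ "bdcbA" ∷ "aCACa" ∷ "BdAd" ∷ "BCAc" ∷ "dcacB" ∷ "AdBd" ∷ "aBAA" ∷ "Abbcd" ∷ "ACBc" ∷ "cACB" ∷ "aCaCA" ∷ "ACCaa" ∷ "aada" ∷ "bcbAd" ∷ "dAcbb" ∷ "aaCCA" ∷ "CBAc" ∷ "adcBc" ∷ "aBCbC" ∷ "dCadC" ∷ "adaa" ∷ "CaC" ∷ [])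
  ∷ ("AcbbA" ∷ "ABAd" ∷ "acBcA" ∷ "AdBA" ∷ "daad" ∷ "abaB" ∷ "BCbCd" ∷ "accAB" ∷ "Cbbb" ∷ "aCCAd" ∷ "AdCCa" ∷ "AbcbA" ∷ "Bcc" ∷ "bCbb" ∷ "AcBac" ∷ "Baab" ∷ "bbCb" ∷ "dAAB" ∷ "baBa" ∷ "AAdB" ∷ "aCdAC" ∷ "dCC" ∷ "ABdA" ∷ "aCAdC" ∷ "AcBca" ∷ "AdaCC" ∷ "ccB" ∷ "baaB" ∷ "CdC" ∷ "adACC" ∷ "Baba" ∷ "aBAcc" ∷ "CCd" ∷ "ACdCa" ∷ "aBab" ∷ "dBAA" ∷ "AABd" ∷ "AcacB" ∷ "aCdCA" ∷ "aCac" ∷ "acaC" ∷ "dada" ∷ "accBA" ∷ "AccaB" ∷ "Caac" ∷ "bAcAb" ∷ "cBc" ∷ "AAcbb" ∷ "acAcB" ∷ "aa" ∷ "BdAA" ∷ "bAbAc" ∷ "dABA" ∷ [])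
  ∷ ("Adaa" ∷ "aBdb" ∷ "aaacc" ∷ "AABA" ∷ "acdC" ∷ "bCBCA" ∷ "Cdca" ∷ "Bdab" ∷ "ad" ∷ "BACCb" ∷ "AACCa" ∷ "AcBcd" ∷ "BCCAb" ∷ "cadC" ∷ "AccdB" ∷ "bbacb" ∷ "Badb" ∷ "caCd" ∷ "Cacd" ∷ "abcbb" ∷ "BAAA" ∷ "AAAB" ∷ "Bdba" ∷ "Babd" ∷ "bACCB" ∷ "ACC" ∷ "bcabb" ∷ "bdBa" ∷ "ABCCb" ∷ "aadA" ∷ "CAC" ∷ "AccBd" ∷ "AdCdC" ∷ "aCdc" ∷ "ACACa" ∷ "badB" ∷ "bdaB" ∷ "aBBBC" ∷ "cdaC" ∷ "ABAA" ∷ "abbcb" ∷ "bCCBA" ∷ "abbbc" ∷ "Cadc" ∷ "abdB" ∷ "da" ∷ "cabbb" ∷ "cdCa" ∷ "CCA" ∷ "Cdac" ∷ "AdcBc" ∷ "ABCbC" ∷ "baBd" ∷ [])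
  ∷ []

word : G → Word
word (x , y) = parse (lookup (lookup certificate x) y)

ValidWord : G → Set
ValidWord z = e ⊲ word z ≡ z × length (word z) ≤ 5

validWord? : ∀ z → Dec (ValidWord z)
validWord? z = (e ⊲ word z ≟G z) ×-dec (length (word z) ≤? 5)

certificate-valid : ∀ x y → ValidWord (x , y)
certificate-valid = from-yes (Fin.all? λ x → Fin.all? λ y → validWord? (x , y))

e-within5 : ∀ z → DistLe e z 5
e-within5 (x , y) = length w , proj₂ valid , subst (λ t → Walk e t (length w)) (proj₁ valid) (walkAlong e w)
  where
  w = word (x , y)
  valid = certificate-valid x y

far-not-within4 : ¬ DistLe e [ 21 , 21 ] 4
far-not-within4 = from-no (DistLe? e [ 21 , 21 ] 4)

diameter5 : Diameter 5
diameter5 = DistLe-fromIdentity e-within5 , e , [ 21 , 21 ] , far-not-within4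

connected : Connected
connected x y = let n , _ , w = proj₁ diameter5 x y in n , w

mainTheorem6 : All (λ g → (g · inv g ≡ e) × (inv g · g ≡ e)) gens
    × All (λ s → inv s ∈ S) S
    × HasExactly (λ s → s ∈ S) 7
    × ¬ (e ∈ S)
    × VertexCount 2756
    × Connected
    × Regular 7
    × Diameter 5
mainTheorem6 =
    All.tabulate (λ {g} _ → ·-inverseʳ g , ·-inverseˡ g)
  , from-yes (All.all? (λ s → inv s ∈? S) S)
  , S-hasExactly7
  , from-no (e ∈? S)
  , vertexCount
  , connected
  , regular7
  , diameter5
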